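{- Let $A=E_1\times E_2$ be a CM product surface and let $\theta=\mathbf D(a,b,h)\in\mathcal P(A)$ with $a,b\in\mathbb Z$, $h\in\operatorname{Hom}(E_1,E_2)$. Then $\theta\in\mathcal P(A)^{\operatorname{ev}}$ if and only if $2\mid a$, $2\mid b$ and $4\mid\operatorname{disc}(q_{E_1,E_2})$. In particular, if $4\mid\operatorname{disc}(q_{E_1,E_2})$ and there is a primitive $h\in\operatorname{Hom}(E_1,E_2)$ with $q_{E_1,E_2}(h)\equiv 3\pmod 4$, then $\mathbf D\big(2,(q_{E_1,E_2}(h)+1)/2,h\big)\in\mathcal P(A)^{\operatorname{ev}}$.
   Context: A CM product surface is $A=E_1\times E_2$ with $E_1,E_2$ isogenous elliptic curves with complex multiplication over an algebraically closed field of characteristic $0$. $q_{E_1,E_2}(h)=\deg(h)$ is the degree form on $\operatorname{Hom}(E_1,E_2)$ (a positive binary form); for a binary form $ax^2+bxy+cy^2$, $\operatorname{disc}=b^2-4ac$. $h$ is primitive if it is not of the form $nh'$ with $n\ge2$, $h'\in\operatorname{Hom}(E_1,E_2)$. $\operatorname{NS}(A)$: divisors modulo numerical equivalence with intersection pairing; $\mathcal P(A)$: classes of ample divisors $D$ with $(D.D)=2$; $\mathcal P(A)^{\operatorname{ev}}=\{\theta\in\mathcal P(A): (D.\theta)\text{ even for all } D\in\operatorname{NS}(A)\}$. $\mathbf D:\mathbb Z\oplus\mathbb Z\oplus\operatorname{Hom}(E_1,E_2)\to\operatorname{NS}(A)$ is the isomorphism $\mathbf D(a,b,h)=a[\{0\}\times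 E_2]+b[E_1\times\{0\}]+\big([\Gamma_h]-\deg(h)[\{0\}\times E_2]-[E_1\times\{0\}]\big)$, $\Gamma_h$ the graph of $h$; one has $(\mathbf D(a,b,h).\mathbf D(a,b,h))=2(ab-\deg h)$, and $\mathbf D(a,b,h)\in\mathcal P(A)$ iff $a>0$ and $ab-\deg(h)=1$. -}

module Defs where

open import Data.Integer using (ℤ; +_; _+_; _-_; _*_; _<_; _≤_; -_)
open import Data.Integer.Divisibility using (_∣_)
open import Data.Product using (_×_; _,_; Σ; ∃)
open import Relation.Binary.PropositionalEquality using (_≡_)
open import Relation.Nullary using (¬_)

-- The degree form q_{E1,E2} on Hom(E1,E2) ≅ ℤ² (a rank-2 lattice for CM curves),
-- written q(x,y) = α x² + β x y + γ y² in a fixed ℤ-basis of Hom(E1,E2).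
record BinForm : Set where
  constructor form
  field
    α β γ : ℤ
open BinForm public

Hom : Set
Hom = ℤ × ℤ

_+ₕ_ : Hom → Hom → Hom
(x , y) +ₕ (x' , y') = (x + x') , (y + y')

_·ₕ_ : ℤ → Hom → Hom
n ·ₕ (x , y) = (n * x) , (n * y)

q : BinForm → Hom → ℤ
q f (x , y) = α f * x * x + β f * x * y + γ f * y * y

disc : BinForm → ℤ
disc f = β f * β f - + 4 * α f * γ f

Positive : BinForm → Set
Positive f = (+ 0 < α f) × (disc f < + 0)

Primitive : Hom → Set
Primitive h = ¬ (Σ ℤ λ n → Σ Hom λ h' → (+ 2 ≤ n) × (h ≡ n ·ₕ h'))

-- NS(A) ≅ ℤ ⊕ ℤ ⊕ Hom(E1,E2) via D(a,b,h)
NS : BinForm → Set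
NS f = ℤ × ℤ × Hom

-- Intersection pairing: the symmetric bilinear form with (D.D) = 2(ab - deg h),
-- i.e. (D(a,b,h).D(a',b',h')) = ab' + a'b - (deg(h+h') - deg h - deg h').
pair : (f : BinForm) → NS f → NS f → ℤ
pair f (a , b , h) (a' , b' , h') =
  a * b' + a' * b - (q f (h +ₕ h') - q f h - q f h')

-- 𝒫(A): ample classes of self-intersection 2, i.e. a > 0 and ab - deg h = 1
InP : (f : BinForm) → NS f → Set
InP f (a , b , h) = (+ 0 < a) × (a * b - q f h ≡ + 1)

InPev : (f : BinForm) → NS f → Set
InPev f θ = InP f θ × ((D : NS f) → + 2 ∣ pair f D θ)

{-# OPTIONS --safe #-}
-- The pairing of θ = D(a,b,h) with D(0,1,0), D(1,0,0) and D(0,0,h') is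
-- a, b and minus the polar form q(h'+h) - q(h') - q(h) = β(xy' + x'y) + 2(αxx' + γyy'), so θ is
-- even exactly when a, b and β are even. Odd β is excluded by the pairings with the basis
-- vectors of Hom: they force h to be even, and then ab - q(h) = 1 would be even. Finally
-- 4 ∣ β² - 4αγ iff 2 ∣ β, by Euclid's lemma for the prime 2.
module Submission where

open import Defs
open import Data.Integer using (ℤ; +_; _+_; _-_; _*_)
open import Data.Integer.Divisibility using (_∣_)
open import Data.Product using (_×_; _,_)
open import Function.Bundles using (_⇔_)
open import Relation.Binary.PropositionalEquality using (_≡_)

open import Data.Empty using (⊥-elim)
open import Data.Integer using (-_; ∣_∣; +<+)
open import Data.Integer.Properties using (abs-*)
open import Data.Integer.Divisibility.Signed
  using (∣ᵤ⇒∣; ∣⇒∣ᵤ; ∣-refl; ∣-trans; ∣m∣n⇒∣m+n; ∣m∣n⇒∣m-n; ∣m+n∣n⇒∣m; ∣m⇒∣-m;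
         ∣m⇒∣m*n; ∣n⇒∣m*n; *-monoʳ-∣; *-monoˡ-∣; *-cancelˡ-∣)
  renaming (_∣_ to _∣ˢ_)
open import Data.Integer.Tactic.RingSolver using (solve-∀)
open import Data.Nat.Base using (s≤s; z≤n)
open import Data.Nat.Divisibility using (∣1⇒≡1) renaming (_∣_ to _∣ℕ_)
open import Data.Nat.Primality using (Prime; prime[2])
import Data.Nat.Primality as ℕ using (euclidsLemma)
open import Data.Sum using (_⊎_; inj₁; inj₂; reduce)
open import Function.Bundles using (mk⇔; Equivalence)
open import Relation.Binary.PropositionalEquality using (sym; trans; cong; subst)
open import Relation.Nullary using (¬_)

euclidsLemma : ∀ {p} m n → Prime p → + p ∣ˢ m * n → (+ p ∣ˢ m) ⊎ (+ p ∣ˢ n)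
euclidsLemma {p} m n prime-p p∣m*n
  with ℕ.euclidsLemma ∣ m ∣ ∣ n ∣ prime-p (subst (p ∣ℕ_) (abs-* m n) (∣⇒∣ᵤ {+ p} {m * n} p∣m*n))
... | inj₁ p∣m = inj₁ (∣ᵤ⇒∣ {+ p} {m} p∣m)
... | inj₂ p∣n = inj₂ (∣ᵤ⇒∣ {+ p} {n} p∣n)

2∤1 : ¬ (+ 2 ∣ˢ + 1)
2∤1 2∣1 with ∣1⇒≡1 (∣⇒∣ᵤ {+ 2} {+ 1} 2∣1)
... | ()

2∣2*n : ∀ n → + 2 ∣ˢ + 2 * n
2∣2*n n = ∣m⇒∣m*n n ∣-refl

2∣m+2*n⇒2∣m : ∀ m n → + 2 ∣ˢ m + + 2 * n → + 2 ∣ˢ m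
2∣m+2*n⇒2∣m m n 2∣m+2n = ∣m+n∣n⇒∣m {m = m} 2∣m+2n (2∣2*n n)

polar : BinForm → Hom → Hom → ℤ
polar f h h' = q f (h +ₕ h') - q f h - q f h'

polar-expansion : ∀ f x y x' y' →
  polar f (x , y) (x' , y') ≡ β f * (x * y' + x' * y) + + 2 * (α f * x * x' + γ f * y * y')
polar-expansion (form α β γ) = expand α β γ
  where
  expand : ∀ α β γ x y x' y' →
    α * (x + x') * (x + x') + β * (x + x') * (y + y') + γ * (y + y') * (y + y')
      - (α * x * x + β * x * y + γ * y * y) - (α * x' * x' + β * x' * y' + γ * y' * y')
    ≡ β * (x * y' + x' * y) + + 2 * (α * x * x' + γ * y * y')
  expand = solve-∀

polar-zeroˡ : ∀ f x y → polar f (+ 0 , + 0) (x , y) ≡ + 0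
polar-zeroˡ f x y = trans (polar-expansion f _ _ x y) (vanish (α f) (β f) (γ f) x y)
  where
  vanish : ∀ α β γ x y → β * (+ 0 * y + x * + 0) + + 2 * (α * + 0 * x + γ * + 0 * y) ≡ + 0
  vanish = solve-∀

polar-e₁ : ∀ f x y → polar f (+ 1 , + 0) (x , y) ≡ β f * y + + 2 * (α f * x)
polar-e₁ f x y = trans (polar-expansion f _ _ x y) (simplify (α f) (β f) (γ f) x y)
  where
  simplify : ∀ α β γ x y →
    β * (+ 1 * y + x * + 0) + + 2 * (α * + 1 * x + γ * + 0 * y) ≡ β * y + + 2 * (α * x)
  simplify = solve-∀

polar-e₂ : ∀ f x y → polar f (+ 0 , + 1) (x , y) ≡ β f * x + + 2 * (γ f * y)
polar-e₂ f x y = trans (polar-expansion f _ _ x y) (simplify (α f) (β f) (γ f) x y)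
  where
  simplify : ∀ α β γ x y →
    β * (+ 0 * y + x * + 1) + + 2 * (α * + 0 * x + γ * + 1 * y) ≡ β * x + + 2 * (γ * y)
  simplify = solve-∀

2∣β⇒2∣polar : ∀ f h h' → + 2 ∣ˢ β f → + 2 ∣ˢ polar f h h'
2∣β⇒2∣polar f (x , y) (x' , y') 2∣β =
  subst (+ 2 ∣ˢ_) (sym (polar-expansion f x y x' y')) (∣m∣n⇒∣m+n (∣m⇒∣m*n _ 2∣β) (2∣2*n _))

2∣q : ∀ f {x y} → + 2 ∣ˢ x → + 2 ∣ˢ y → + 2 ∣ˢ q f (x , y)
2∣q f {x} {y} 2∣x 2∣y =
  ∣m∣n⇒∣m+n (∣m∣n⇒∣m+n (∣m⇒∣m*n x (∣n⇒∣m*n (α f) 2∣x)) (∣m⇒∣m*n y (∣n⇒∣m*n (β f) 2∣x)))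
            (∣m⇒∣m*n y (∣n⇒∣m*n (γ f) 2∣y))

4∣4*α*γ : ∀ f → + 4 ∣ˢ + 4 * α f * γ f
4∣4*α*γ f = ∣m⇒∣m*n (γ f) (∣m⇒∣m*n (α f) ∣-refl)

2∣β⇒4∣disc : ∀ f → + 2 ∣ˢ β f → + 4 ∣ˢ disc f
2∣β⇒4∣disc f 2∣β = ∣m∣n⇒∣m-n 4∣β*β (4∣4*α*γ f)
  where
  4∣β*β : + 4 ∣ˢ β f * β f
  4∣β*β = ∣-trans (*-monoʳ-∣ (+ 2) 2∣β) (*-monoˡ-∣ (β f) 2∣β)

4∣disc⇒2∣β : ∀ f → + 4 ∣ˢ disc f → + 2 ∣ˢ β f
4∣disc⇒2∣β f 4∣disc =
  reduce (euclidsLemma (β f) (β f) prime[2] (∣-trans (∣m⇒∣m*n (+ 2) ∣-refl) 4∣β*β))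
  where
  4∣β*β : + 4 ∣ˢ β f * β f
  4∣β*β = ∣m+n∣n⇒∣m {m = β f * β f} 4∣disc (∣m⇒∣-m (4∣4*α*γ f))

IsEvenClass : (f : BinForm) → NS f → Set
IsEvenClass f θ = (D : NS f) → + 2 ∣ pair f D θ

module _ {f : BinForm} {a b : ℤ} {h : Hom} (even : IsEvenClass f (a , b , h)) where

  2∣pairing : ∀ D → + 2 ∣ˢ pair f D (a , b , h)
  2∣pairing D = ∣ᵤ⇒∣ {+ 2} (even D)

  IsEvenClass⇒2∣a : + 2 ∣ˢ a
  IsEvenClass⇒2∣a = subst (+ 2 ∣ˢ_) pair-[E₁×0] (2∣pairing (+ 0 , + 1 , (+ 0 , + 0)))
    where
    simplify : ∀ a b → + 0 * b + a * + 1 - + 0 ≡ a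
    simplify = solve-∀
    pair-[E₁×0] : pair f (+ 0 , + 1 , (+ 0 , + 0)) (a , b , h) ≡ a
    pair-[E₁×0] = trans (cong (λ p → + 0 * b + a * + 1 - p) (polar-zeroˡ f _ _)) (simplify a b)

  IsEvenClass⇒2∣b : + 2 ∣ˢ b
  IsEvenClass⇒2∣b = subst (+ 2 ∣ˢ_) pair-[0×E₂] (2∣pairing (+ 1 , + 0 , (+ 0 , + 0)))
    where
    simplify : ∀ a b → + 1 * b + a * + 0 - + 0 ≡ b
    simplify = solve-∀
    pair-[0×E₂] : pair f (+ 1 , + 0 , (+ 0 , + 0)) (a , b , h) ≡ b
    pair-[0×E₂] = trans (cong (λ p → + 1 * b + a * + 0 - p) (polar-zeroˡ f _ _)) (simplify a b)

  IsEvenClass⇒2∣polar : ∀ h' → + 2 ∣ˢ polar f h' h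
  IsEvenClass⇒2∣polar h' =
    subst (+ 2 ∣ˢ_) (negate-pair-Hom a b _) (∣m⇒∣-m (2∣pairing (+ 0 , + 0 , h')))
    where
    negate-pair-Hom : ∀ a b p → - (+ 0 * b + a * + 0 - p) ≡ p
    negate-pair-Hom = solve-∀

¬InP-of-2∣ : ∀ f {a b x y} → + 2 ∣ˢ a → + 2 ∣ˢ x → + 2 ∣ˢ y → ¬ InP f (a , b , (x , y))
¬InP-of-2∣ f {b = b} 2∣a 2∣x 2∣y (_ , ab-q≡1) =
  2∤1 (subst (+ 2 ∣ˢ_) ab-q≡1 (∣m∣n⇒∣m-n (∣m⇒∣m*n b 2∣a) (2∣q f 2∣x 2∣y)))

IsEvenClass⇒2∣β : ∀ f {a b x y} → InP f (a , b , (x , y)) → IsEvenClass f (a , b , (x , y)) →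
  + 2 ∣ˢ β f
IsEvenClass⇒2∣β f {a} {b} {x} {y} inP even =
  conclude (euclidsLemma (β f) y prime[2] (2∣m+2*n⇒2∣m _ _ (even-at (+ 1 , + 0) (polar-e₁ f x y))))
           (euclidsLemma (β f) x prime[2] (2∣m+2*n⇒2∣m _ _ (even-at (+ 0 , + 1) (polar-e₂ f x y))))
  where
  even-at : ∀ e {p} → polar f e (x , y) ≡ p → + 2 ∣ˢ p
  even-at e eq = subst (+ 2 ∣ˢ_) eq (IsEvenClass⇒2∣polar {f} {a} {b} even e)
  conclude : (+ 2 ∣ˢ β f) ⊎ (+ 2 ∣ˢ y) → (+ 2 ∣ˢ β f) ⊎ (+ 2 ∣ˢ x) → + 2 ∣ˢ β f
  conclude (inj₁ 2∣β) _          = 2∣β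
  conclude (inj₂ _)   (inj₁ 2∣β) = 2∣β
  conclude (inj₂ 2∣y) (inj₂ 2∣x) =
    ⊥-elim (¬InP-of-2∣ f (IsEvenClass⇒2∣a {f} {a} {b} even) 2∣x 2∣y inP)

2∣⇒IsEvenClass : ∀ f {a b} h → + 2 ∣ˢ a → + 2 ∣ˢ b → + 2 ∣ˢ β f → IsEvenClass f (a , b , h)
2∣⇒IsEvenClass f {a} {b} h 2∣a 2∣b 2∣β D@(a' , b' , h') = ∣⇒∣ᵤ {+ 2} {pair f D (a , b , h)}
  (∣m∣n⇒∣m-n (∣m∣n⇒∣m+n (∣n⇒∣m*n a' 2∣b) (∣m⇒∣m*n b' 2∣a)) (2∣β⇒2∣polar f h' h 2∣β))

InPev⇔2∣∧2∣∧4∣disc : ∀ f a b h → InP f (a , b , h) →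
  InPev f (a , b , h) ⇔ ((+ 2 ∣ a) × (+ 2 ∣ b) × (+ 4 ∣ disc f))
InPev⇔2∣∧2∣∧4∣disc f a b h inP = mk⇔
  (λ (_ , even) → ∣⇒∣ᵤ {+ 2} (IsEvenClass⇒2∣a {f} {a} {b} even)
                , ∣⇒∣ᵤ {+ 2} (IsEvenClass⇒2∣b {f} {a} {b} even)
                , ∣⇒∣ᵤ {+ 4} (2∣β⇒4∣disc f (IsEvenClass⇒2∣β f inP even)))
  (λ (2∣a , 2∣b , 4∣disc) → inP , 2∣⇒IsEvenClass f {a} {b} h (∣ᵤ⇒∣ {+ 2} 2∣a) (∣ᵤ⇒∣ {+ 2} 2∣b)
                                     (4∣disc⇒2∣β f (∣ᵤ⇒∣ {+ 4} 4∣disc)))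

InP-[2,b,h] : ∀ f {b} h → + 2 * b ≡ q f h + + 1 → InP f (+ 2 , b , h)
InP-[2,b,h] f h 2b≡q+1 = +<+ (s≤s z≤n) , trans (cong (_- q f h) 2b≡q+1) (cancel (q f h))
  where
  cancel : ∀ m → m + + 1 - m ≡ + 1
  cancel = solve-∀

2∣half-of-3-mod-4 : ∀ m {b} → + 4 ∣ˢ m - + 3 → + 2 * b ≡ m + + 1 → + 2 ∣ˢ b
2∣half-of-3-mod-4 m 4∣m-3 2b≡m+1 =
  *-cancelˡ-∣ (+ 2) (subst (+ 4 ∣ˢ_) (trans (shift m) (sym 2b≡m+1)) (∣m∣n⇒∣m+n 4∣m-3 ∣-refl))
  where
  shift : ∀ m → m - + 3 + + 4 ≡ m + + 1
  shift = solve-∀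

proposition16 : (f : BinForm) → Positive f →
    (((a b : ℤ) (h : Hom) → InP f (a , b , h) →
    (InPev f (a , b , h) ⇔ ((+ 2 ∣ a) × (+ 2 ∣ b) × (+ 4 ∣ disc f))))
    × (+ 4 ∣ disc f → (h : Hom) → Primitive h → + 4 ∣ (q f h - + 3) →
    (b : ℤ) → + 2 * b ≡ q f h + + 1 → InPev f (+ 2 , b , h)))
proposition16 f _ = InPev⇔2∣∧2∣∧4∣disc f , evenClass
  where
  evenClass : + 4 ∣ disc f → (h : Hom) → Primitive h → + 4 ∣ (q f h - + 3) →
    (b : ℤ) → + 2 * b ≡ q f h + + 1 → InPev f (+ 2 , b , h)
  evenClass 4∣disc h _ 4∣q-3 b 2b≡q+1 =
    Equivalence.from (InPev⇔2∣∧2∣∧4∣disc f (+ 2) b h (InP-[2,b,h] f h 2b≡q+1))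
      ( ∣⇒∣ᵤ {+ 2} ∣-refl
      , ∣⇒∣ᵤ {+ 2} (2∣half-of-3-mod-4 (q f h) (∣ᵤ⇒∣ {+ 4} 4∣q-3) 2b≡q+1)
      , 4∣disc)
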